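{- Let $P_n$ be the path of order $n\ge 3$, $G_1,G_2$ disjoint copies of $P_n$, and $\sigma:V(G_1)\to V(G_2)$ a bijection. Then $2\le Z(C(P_n,\sigma))\le n$.
   Context: Zero forcing: color each vertex of a graph $H$ black or white, with $S$ the initial set of black vertices. The color-change rule turns a white vertex $u_2$ black if $u_2$ is the only white neighbor of some black vertex $u_1$. $S$ is a zero forcing set of $H$ if all vertices become black after finitely many applications of the rule. $Z(H)$ is the minimum size of a zero forcing set of $H$. Functigraph: given disjoint copies $G_1,G_2$ of $G$ and $f:V(G_1)\to V(G_2)$, $C(G,f)$ has vertex set $V(G_1)\cup V(G_2)$ and edge set $E(G_1)\cup E(G_2)\cup\{uv \mid v=f(u)\}$. -}

module Defs where

open import Data.Nat using (ℕ; suc; _+_)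
open import Data.Fin using (Fin; toℕ; splitAt)
open import Data.Fin.Subset using (Subset; _∈_; _∉_; ⁅_⁆; _∪_; ⊤)
open import Data.Sum using (_⊎_; inj₁; inj₂)
open import Data.Empty using (⊥)
open import Relation.Binary.PropositionalEquality using (_≡_; _≢_)
open import Relation.Binary.Construct.Closure.ReflexiveTransitive using (Star)

Graph : ℕ → Set₁
Graph m = Fin m → Fin m → Set

data ForceStep {m : ℕ} (H : Graph m) : Subset m → Subset m → Set where
  force : ∀ {B : Subset m} (u₁ u₂ : Fin m) →
          u₁ ∈ B → u₂ ∉ B → H u₁ u₂ →
          (∀ w → H u₁ w → w ≢ u₂ → w ∈ B) →
          ForceStep H B (⁅ u₂ ⁆ ∪ B)

IsZeroForcingSet : {m : ℕ} → Graph m → Subset m → Set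
IsZeroForcingSet H S = Star (ForceStep H) S ⊤

PathAdj : (n : ℕ) → Fin n → Fin n → Set
PathAdj n i j = (suc (toℕ i) ≡ toℕ j) ⊎ (suc (toℕ j) ≡ toℕ i)

FAdj : {n : ℕ} → Graph n → (Fin n → Fin n) → Fin n ⊎ Fin n → Fin n ⊎ Fin n → Set
FAdj G f (inj₁ a) (inj₁ b) = G a b
FAdj G f (inj₂ a) (inj₂ b) = G a b
FAdj G f (inj₁ a) (inj₂ b) = f a ≡ b
FAdj G f (inj₂ b) (inj₁ a) = f a ≡ b

-- Functigraph C(G,f): vertices of G₁ are the first n elements of Fin (n + n),
-- those of G₂ the last n.
Functigraph : {n : ℕ} → Graph n → (Fin n → Fin n) → Graph (n + n)
Functigraph {n} G f x y = FAdj G f (splitAt n x) (splitAt n y)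

module Submission where

-- Lower bound: every vertex of C(P_n, σ) has a path neighbour on its own side
-- and a σ-partner on the other, so a vertex with a neighbour has at least two;
-- the first force therefore already needs two black vertices.
-- Upper bound: once all of G₁ is black, a vertex a of G₁ has σ(a) as its only
-- neighbour outside G₁, so it forces σ(a); as σ is onto, all of G₂ follows.

open import Defs
open import Data.Nat using (ℕ; zero; suc; _+_; _≤_; _<_; s≤s; z≤n)
open import Data.Nat.Induction using (<-wellFounded)
open import Data.Nat.Properties using (≤-trans; ≤-reflexive; 1+n≢n)
open import Data.Fin using (Fin; zero; suc; toℕ; inject₁; splitAt; join; _↑ˡ_; _↑ʳ_)
open import Data.Fin.Properties
  using (toℕ-inject₁; splitAt-join; splitAt-↑ˡ; splitAt⁻¹-↑ˡ; splitAt⁻¹-↑ʳ)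
open import Data.Fin.Subset
  using (Subset; ∣_∣; _∈_; _∉_; _⊆_; ⁅_⁆; _∪_; ∁; ⊤; ⊥; Empty)
open import Data.Fin.Subset.Properties
  using ( p⊆q⇒∣p∣≤∣q∣; p⊂q⇒∣p∣<∣q∣; p⊂q⇒∁p⊃∁q; ∣⁅x⁆∣≡1; ∣⊤∣≡n; ∣⊥∣≡0
        ; x∈⁅y⁆⇒x≡y; x∈⁅x⁆; x∈p∪q⁺; q⊆p∪q; ⊆-refl; ⊆-trans; ⊆⊤; ⊆-antisym
        ; x∈p⇒∣p-x∣<∣p∣; x∈p∧x≢y⇒x∈p-y; x∈∁p⇒x∉p; x∉∁p⇒x∈p; nonempty? )
open import Data.Vec using (_++_; here; there)
open import Data.Product using (_×_; _,_; proj₁; proj₂; ∃)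
open import Data.Sum using (_⊎_; inj₁; inj₂; [_,_])
open import Data.Empty using (⊥-elim)
open import Function.Definitions using (Bijective; StrictlySurjective)
open import Function.Consequences.Propositional using (surjective⇒strictlySurjective)
open import Induction.WellFounded using (Acc; acc)
open import Relation.Nullary using (¬_; yes; no)
open import Relation.Binary.Definitions using (Irreflexive)
open import Relation.Binary.PropositionalEquality
  using (_≡_; _≢_; refl; sym; trans; cong; subst; subst₂)
open import Relation.Binary.Construct.Closure.ReflexiveTransitive using (Star; ε; _◅_)

1≤∣p∣ : ∀ {m} {x : Fin m} {p : Subset m} → x ∈ p → 1 ≤ ∣ p ∣
1≤∣p∣ {x = x} {p} x∈p = subst (_≤ ∣ p ∣) (∣⁅x⁆∣≡1 x) (p⊆q⇒∣p∣≤∣q∣ ⁅x⁆⊆p)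
  where
  ⁅x⁆⊆p : ⁅ x ⁆ ⊆ p
  ⁅x⁆⊆p y∈⁅x⁆ = subst (_∈ p) (sym (x∈⁅y⁆⇒x≡y x y∈⁅x⁆)) x∈p

2≤∣p∣ : ∀ {m} {x y : Fin m} {p : Subset m} → x ∈ p → y ∈ p → x ≢ y → 2 ≤ ∣ p ∣
2≤∣p∣ x∈p y∈p x≢y =
  ≤-trans (s≤s (1≤∣p∣ (x∈p∧x≢y⇒x∈p-y y∈p (λ y≡x → x≢y (sym y≡x))))) (x∈p⇒∣p-x∣<∣p∣ x∈p)

Empty-∁⇒≡⊤ : ∀ {m} {p : Subset m} → Empty (∁ p) → p ≡ ⊤
Empty-∁⇒≡⊤ noWhite = ⊆-antisym ⊆⊤ (λ {x} _ → x∉∁p⇒x∈p (λ x∈∁p → noWhite (x , x∈∁p)))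

NoLeaves : ∀ {m} → Graph m → Set
NoLeaves H = ∀ u v → H u v → ∃ λ w → H u w × w ≢ v

2≤∣zeroForcingSet∣ : ∀ {m} {H : Graph m} {S : Subset m} → 2 ≤ m →
  Irreflexive _≡_ H → NoLeaves H → IsZeroForcingSet H S → 2 ≤ ∣ S ∣
2≤∣zeroForcingSet∣ {m} 2≤m _ _ ε = subst (2 ≤_) (sym (∣⊤∣≡n m)) 2≤m
2≤∣zeroForcingSet∣ _ irr noLeaves (force u₁ u₂ u₁∈S _ u₁~u₂ othersBlack ◅ _)
  with noLeaves u₁ u₂ u₁~u₂
... | w , u₁~w , w≢u₂ = 2≤∣p∣ u₁∈S (othersBlack w u₁~w w≢u₂) (λ u₁≡w → irr u₁≡w u₁~w)

forcesEverywhere⇒zeroForcingSet : ∀ {m} {H : Graph m} {S : Subset m} →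
  (∀ {B} → S ⊆ B → ∀ {x} → x ∉ B → ForceStep H B (⁅ x ⁆ ∪ B)) →
  IsZeroForcingSet H S
forcesEverywhere⇒zeroForcingSet {H = H} {S} step = go ⊆-refl (<-wellFounded ∣ ∁ S ∣)
  where
  go : ∀ {B} → S ⊆ B → Acc _<_ ∣ ∁ B ∣ → Star (ForceStep H) B ⊤
  go {B} S⊆B (acc rs) with nonempty? (∁ B)
  ... | no noWhite = subst (Star (ForceStep H) B) (Empty-∁⇒≡⊤ noWhite) ε
  ... | yes (x , x∈∁B) =
    step S⊆B x∉B ◅ go (⊆-trans S⊆B (q⊆p∪q ⁅ x ⁆ B)) (rs fewerWhite)
    where
    x∉B : x ∉ B
    x∉B = x∈∁p⇒x∉p x∈∁B
    fewerWhite : ∣ ∁ (⁅ x ⁆ ∪ B) ∣ < ∣ ∁ B ∣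
    fewerWhite = p⊂q⇒∣p∣<∣q∣ (p⊂q⇒∁p⊃∁q
      (q⊆p∪q ⁅ x ⁆ B , x , x∈p∪q⁺ (inj₁ (x∈⁅x⁆ x)) , x∉B))

LeftCopy : (n : ℕ) → Subset (n + n)
LeftCopy n = ⊤ {n} ++ ⊥ {n}

∣⊤++⊥∣≡m : ∀ m l → ∣ ⊤ {m} ++ ⊥ {l} ∣ ≡ m
∣⊤++⊥∣≡m zero    l = ∣⊥∣≡0 l
∣⊤++⊥∣≡m (suc m) l = cong suc (∣⊤++⊥∣≡m m l)

↑ˡ∈⊤++ : ∀ {m l} (a : Fin m) (q : Subset l) → a ↑ˡ l ∈ ⊤ {m} ++ q
↑ˡ∈⊤++ zero    q = here
↑ˡ∈⊤++ (suc a) q = there (↑ˡ∈⊤++ a q)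

∈LeftCopy : ∀ {n} {x : Fin (n + n)} {a : Fin n} → splitAt n x ≡ inj₁ a → x ∈ LeftCopy n
∈LeftCopy {n} {a = a} x≡ = subst (_∈ LeftCopy n) (splitAt⁻¹-↑ˡ x≡) (↑ˡ∈⊤++ a ⊥)

module _ {n : ℕ} (G : Graph n) (f : Fin n → Fin n) where

  FAdj-irreflexive : Irreflexive _≡_ G → ∀ p → ¬ FAdj G f p p
  FAdj-irreflexive irr (inj₁ a) = irr refl
  FAdj-irreflexive irr (inj₂ a) = irr refl

  functigraph-irreflexive : Irreflexive _≡_ G → Irreflexive _≡_ (Functigraph G f)
  functigraph-irreflexive irr {x} refl = FAdj-irreflexive irr (splitAt n x)

  FAdj-noLeaves : (∀ a → ∃ (G a)) → StrictlySurjective _≡_ f →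
    ∀ p q → ∃ λ r → FAdj G f p r × r ≢ q
  FAdj-noLeaves nbr surj (inj₁ a) (inj₁ _) = inj₂ (f a) , refl , λ ()
  FAdj-noLeaves nbr surj (inj₁ a) (inj₂ _) = inj₁ (proj₁ (nbr a)) , proj₂ (nbr a) , λ ()
  FAdj-noLeaves nbr surj (inj₂ b) (inj₁ _) = inj₂ (proj₁ (nbr b)) , proj₂ (nbr b) , λ ()
  FAdj-noLeaves nbr surj (inj₂ b) (inj₂ _) = inj₁ (proj₁ (surj b)) , proj₂ (surj b) , λ ()

  functigraph-noLeaves : (∀ a → ∃ (G a)) → StrictlySurjective _≡_ f →
    NoLeaves (Functigraph G f)
  functigraph-noLeaves nbr surj u v _ with FAdj-noLeaves nbr surj (splitAt n u) (splitAt n v)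
  ... | r , u~r , r≢v = join n n r , u~join , join≢v
    where
    u~join : Functigraph G f u (join n n r)
    u~join = subst (FAdj G f (splitAt n u)) (sym (splitAt-join n n r)) u~r
    join≢v : join n n r ≢ v
    join≢v refl = r≢v (sym (splitAt-join n n r))

  neighbours-↑ˡ : ∀ a {w} → Functigraph G f (a ↑ˡ n) w → w ∈ LeftCopy n ⊎ w ≡ n ↑ʳ f a
  neighbours-↑ˡ a {w} a~w with splitAt n w in w≡
  ... | inj₁ _ = inj₁ (∈LeftCopy w≡)
  ... | inj₂ c = inj₂ (trans (sym (splitAt⁻¹-↑ʳ w≡)) (cong (n ↑ʳ_) (sym fa≡c)))
    where
    fa≡c : f a ≡ c
    fa≡c = subst (λ p → FAdj G f p (inj₂ c)) (splitAt-↑ˡ n a n) a~w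

  forceIntoRightCopy : StrictlySurjective _≡_ f → ∀ {B} → LeftCopy n ⊆ B →
    ∀ {x} → x ∉ B → ForceStep (Functigraph G f) B (⁅ x ⁆ ∪ B)
  forceIntoRightCopy surj {B} L⊆B {x} x∉B with splitAt n x in x≡
  ... | inj₁ _ = ⊥-elim (x∉B (L⊆B (∈LeftCopy x≡)))
  ... | inj₂ b with surj b
  ... | a , fa≡b = force (a ↑ˡ n) x (L⊆B (↑ˡ∈⊤++ a ⊥)) x∉B a~x othersBlack
    where
    a~x : Functigraph G f (a ↑ˡ n) x
    a~x = subst₂ (FAdj G f) (sym (splitAt-↑ˡ n a n)) (sym x≡) fa≡b
    x≡↑ʳ : x ≡ n ↑ʳ f a
    x≡↑ʳ = trans (sym (splitAt⁻¹-↑ʳ x≡)) (cong (n ↑ʳ_) (sym fa≡b))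
    othersBlack : ∀ w → Functigraph G f (a ↑ˡ n) w → w ≢ x → w ∈ B
    othersBlack w a~w w≢x =
      [ L⊆B , (λ w≡↑ʳ → ⊥-elim (w≢x (trans w≡↑ʳ (sym x≡↑ʳ)))) ] (neighbours-↑ˡ a a~w)

  leftCopy-isZeroForcingSet : StrictlySurjective _≡_ f →
    IsZeroForcingSet (Functigraph G f) (LeftCopy n)
  leftCopy-isZeroForcingSet surj = forcesEverywhere⇒zeroForcingSet (forceIntoRightCopy surj)

pathAdj-irreflexive : ∀ {n} → Irreflexive _≡_ (PathAdj n)
pathAdj-irreflexive refl (inj₁ e) = 1+n≢n e
pathAdj-irreflexive refl (inj₂ e) = 1+n≢n e

pathAdj-neighbour : ∀ {n} (a : Fin (suc (suc n))) → ∃ (PathAdj (suc (suc n)) a)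
pathAdj-neighbour zero    = suc zero , inj₁ refl
pathAdj-neighbour (suc a) = inject₁ a , inj₂ (cong suc (toℕ-inject₁ a))

corollary6p3 : (n : ℕ) → 3 ≤ n → (σ : Fin n → Fin n) → Bijective _≡_ _≡_ σ →
    (∃ λ (S : Subset (n + n)) → IsZeroForcingSet (Functigraph (PathAdj n) σ) S × ∣ S ∣ ≤ n)
    × (∀ (S : Subset (n + n)) → IsZeroForcingSet (Functigraph (PathAdj n) σ) S → 2 ≤ ∣ S ∣)
corollary6p3 n@(suc (suc (suc _))) (s≤s (s≤s (s≤s _))) σ (_ , σ-surjective) = upper , lower
  where
  H : Graph (n + n)
  H = Functigraph (PathAdj n) σ
  surj : StrictlySurjective _≡_ σ
  surj = surjective⇒strictlySurjective σ-surjective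
  upper : ∃ λ S → IsZeroForcingSet H S × ∣ S ∣ ≤ n
  upper = LeftCopy n , leftCopy-isZeroForcingSet (PathAdj n) σ surj , ≤-reflexive (∣⊤++⊥∣≡m n n)
  lower : ∀ S → IsZeroForcingSet H S → 2 ≤ ∣ S ∣
  lower S = 2≤∣zeroForcingSet∣ (s≤s (s≤s z≤n))
    (functigraph-irreflexive (PathAdj n) σ pathAdj-irreflexive)
    (functigraph-noLeaves (PathAdj n) σ pathAdj-neighbour surj)
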